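{- Let $\mathcal{C}$ be the monotone grid class with 8 columns and 4 rows whose increasing cells, written as (column, row), are $(1,1),(2,3),(3,4),(4,2),(5,3),(6,1),(7,2),(8,4)$ and all of whose other cells are empty. Then $\mathcal{C}$ is exactly the set of permutations in $\operatorname{Av}(2143,4321)$ having at most 2 descents.
   Context: A descent of a permutation $\pi$ is an index $i$ with $\pi(i)>\pi(i+1)$. Pattern containment: $\pi$ contains $\sigma$ if some subsequence of $\pi$ is order-isomorphic to $\sigma$; $\operatorname{Av}(B)$ is the set of permutations containing no element of $B$. Monotone grid class: with columns numbered left to right and rows bottom to top, a permutation $\pi$ of length $n$ belongs to the class if there are $0=c_0\le\dots\le c_k=n$ and $0=r_0\le\dots\le r_l=n$ such that for each cell $(i,j)$ the points $(p,\pi(p))$ with $c_{i-1}<p\le c_i$, $r_{j-1}<\pi(p)\le r_j$ form an increasing sequence (possibly empty) if the cell is increasing, and there are no such points if the cell is empty. -}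

module Defs where

open import Data.Nat using (ℕ; zero; suc; _≤_; _<_; _+_)
import Data.Nat
open import Data.Fin using (Fin; toℕ; inject₁; _≟_) renaming (zero to fz; suc to fs)
open import Data.Fin.Permutation using (Permutation′; _⟨$⟩ʳ_)
open import Data.List using (List; []; _∷_; map; allFin)
open import Data.Product using (Σ; _×_; _,_; ∃)
open import Data.Empty using (⊥)
open import Relation.Nullary using (¬_; yes; no)
open import Relation.Binary.PropositionalEquality using (_≡_)
open import Data.Vec using (Vec; lookup) renaming ([] to []ᵛ; _∷_ to _∷ᵛ_)

-- Permutations of length n: bijections of Fin n (positions and values 0-based).
Perm : ℕ → Set
Perm n = Permutation′ n

_⟨_⟩ : ∀ {n} → Perm n → Fin n → ℕ
π ⟨ i ⟩ = toℕ (π ⟨$⟩ʳ i)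

Contains : ∀ {n k} → Perm n → (Fin k → Fin k) → Set
Contains {n} {k} π σ =
  Σ (Fin k → Fin n) λ e →
    (∀ (i j : Fin k) → toℕ i < toℕ j → toℕ (e i) < toℕ (e j)) ×
    (∀ (i j : Fin k) → (toℕ (σ i) < toℕ (σ j) → π ⟨ e i ⟩ < π ⟨ e j ⟩)
                      × (π ⟨ e i ⟩ < π ⟨ e j ⟩ → toℕ (σ i) < toℕ (σ j)))

-- Patterns given by one-line notation (1-based digits), stored 0-based.
pat : ∀ {k} → Vec (Fin k) k → Fin k → Fin k
pat v i = lookup v i

p2143 : Fin 4 → Fin 4
p2143 = pat (fs fz ∷ᵛ fz ∷ᵛ fs (fs (fs fz)) ∷ᵛ fs (fs fz) ∷ᵛ []ᵛ)

p4321 : Fin 4 → Fin 4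
p4321 = pat (fs (fs (fs fz)) ∷ᵛ fs (fs fz) ∷ᵛ fs fz ∷ᵛ fz ∷ᵛ []ᵛ)

InAv2143-4321 : ∀ {n} → Perm n → Set
InAv2143-4321 π = ¬ Contains π p2143 × ¬ Contains π p4321

desFrom : ℕ → List ℕ → ℕ
desFrom x [] = 0
desFrom x (y ∷ xs) = isDes x y + desFrom y xs
  where
    isDes : ℕ → ℕ → ℕ
    isDes a b with Data.Nat._<?_ b a
    ... | yes _ = 1
    ... | no _ = 0

desList : List ℕ → ℕ
desList [] = 0
desList (x ∷ xs) = desFrom x xs

des : ∀ {n} → Perm n → ℕ
des {n} π = desList (map (π ⟨_⟩) (allFin n))

-- Monotone grid classes (only increasing and empty cells are needed).
data Cell : Set where
  inc empty : Cell

-- Grid matrix with k columns and l rows: M i j is the cell in column i, row j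
-- (0-based; columns left to right, rows bottom to top).
-- Column i contains positions p (0-based) with c (inject₁ i) ≤ p < c (suc i),
-- i.e. c_{i-1} < p+1 ≤ c_i in 1-based terms; similarly for rows and values.
InGrid : ∀ {k l} → (Fin k → Fin l → Cell) → ∀ {n} → Perm n → Set
InGrid {k} {l} M {n} π =
  Σ (Fin (suc k) → ℕ) λ c → Σ (Fin (suc l) → ℕ) λ r →
    (c fz ≡ 0) × (c (Data.Fin.fromℕ k) ≡ n) ×
    (∀ (i : Fin k) → c (inject₁ i) ≤ c (fs i)) ×
    (r fz ≡ 0) × (r (Data.Fin.fromℕ l) ≡ n) ×
    (∀ (j : Fin l) → r (inject₁ j) ≤ r (fs j)) ×
    (∀ (i : Fin k) (j : Fin l) → CellOK (M i j) (InCell c r i j))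
  where
    import Data.Fin
    InCell : (Fin (suc k) → ℕ) → (Fin (suc l) → ℕ) → Fin k → Fin l → Fin n → Set
    InCell c r i j p = (c (inject₁ i) ≤ toℕ p) × (toℕ p < c (fs i)) ×
                       (r (inject₁ j) ≤ π ⟨ p ⟩) × (π ⟨ p ⟩ < r (fs j))
    CellOK : Cell → (Fin n → Set) → Set
    CellOK inc P = ∀ (p q : Fin n) → P p → P q → toℕ p < toℕ q → π ⟨ p ⟩ < π ⟨ q ⟩
    CellOK empty P = ∀ (p : Fin n) → P p → ⊥

rowOf : Fin 8 → Fin 4
rowOf = pat′ where
  pat′ : Fin 8 → Fin 4
  pat′ i = lookup (fz ∷ᵛ fs (fs fz) ∷ᵛ fs (fs (fs fz)) ∷ᵛ fs fz ∷ᵛ fs (fs fz) ∷ᵛ fz ∷ᵛ fs fz ∷ᵛ fs (fs (fs fz)) ∷ᵛ []ᵛ) i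

gridC : Fin 8 → Fin 4 → Cell
gridC i j with rowOf i ≟ j
... | yes _ = inc
... | no _ = empty

-- A descent of a gridded permutation must step to a later column whose row is not higher. Along the row
-- sequence 1,3,4,2,3,1,2,4 of the columns such steps chain at most twice, as a potential decreasing along
-- them shows; this bounds the descents by 2 and excludes 4321, and a finite check of the columns excludes 2143.
-- Conversely, two descents cut π into three increasing runs A, B, C. Cut the rows at the first value r₁ of B,
-- just above its last value r₃, and at the first value r₂ of A reaching r₁ (or at r₃ if that value is not below
-- r₃). Then A splits into columns of rows 1,3,4, B into rows 2,3 and C into rows 1,2,4: a value of C in
-- [r₂, r₃) would complete a 2143 with the two ends of B and the point of A of value r₂.

module Submission where

open import Defs
open import Data.Nat using (ℕ; zero; suc; _≤_; _<_; z≤n; s≤s; _<?_; _≤?_)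
open import Data.Nat.Properties hiding (_≟_)
open import Data.Fin using (Fin; toℕ; fromℕ; fromℕ<; inject₁; _≟_) renaming (zero to fz; suc to fs)
open import Data.Fin.Patterns using (0F; 1F; 2F; 3F; 4F; 5F; 6F; 7F)
open import Data.Fin.Properties using (toℕ-injective; toℕ-inject₁; toℕ<n; fromℕ<-toℕ; toℕ-fromℕ<; ≤̄⇒inject₁<; all?)
open import Data.List using (List; []; _∷_; tabulate)
open import Data.List.Properties using (map-tabulate)
open import Data.Product using (Σ; _×_; _,_; proj₁; proj₂)
open import Data.Sum using (_⊎_; inj₁; inj₂)
open import Data.Empty using (⊥; ⊥-elim)
open import Data.Unit using (tt)
open import Data.Vec using (lookup) renaming ([] to []ᵛ; _∷_ to _∷ᵛ_)
open import Function using (id; _∘_)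
open import Function.Bundles using (Injection; _⇔_; mk⇔)
open import Function.Properties.Inverse using (↔⇒↣)
open import Relation.Nullary using (¬_; yes; no; Dec)
open import Relation.Nullary.Decidable using (True; toWitness; _×-dec_; _→-dec_)
open import Relation.Binary.PropositionalEquality
open import Relation.Binary.Definitions using (tri<; tri≈; tri>)

descents≤potential : ∀ {m} (f Φ : Fin (suc m) → ℕ) →
  (∀ i → Φ (fs i) ≤ Φ (inject₁ i)) →
  (∀ i → f (fs i) < f (inject₁ i) → Φ (fs i) < Φ (inject₁ i)) →
  desList (tabulate f) ≤ Φ fz
descents≤potential {zero}  f Φ _ _ = z≤n
descents≤potential {suc m} f Φ antitone drops with f 1F <? f 0F
... | yes f1<f0 = begin
  suc (desList (tabulate (f ∘ fs)))    ≤⟨ s≤s (descents≤potential (f ∘ fs) (Φ ∘ fs) (antitone ∘ fs) (drops ∘ fs)) ⟩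
  suc (Φ 1F)                           ≤⟨ drops 0F f1<f0 ⟩
  Φ 0F                                 ∎
  where open ≤-Reasoning
... | no f1≮f0 = begin
  desList (tabulate (f ∘ fs))          ≤⟨ descents≤potential (f ∘ fs) (Φ ∘ fs) (antitone ∘ fs) (drops ∘ fs) ⟩
  Φ 1F                                 ≤⟨ antitone 0F ⟩
  Φ 0F                                 ∎
  where open ≤-Reasoning

segment : (ℕ → ℕ) → ℕ → List ℕ
segment g zero    = []
segment g (suc m) = g 0 ∷ segment (g ∘ suc) m

tabulate≡segment : ∀ {m} (f : Fin m → ℕ) (g : ℕ → ℕ) → (∀ i → f i ≡ g (toℕ i)) → tabulate f ≡ segment g m
tabulate≡segment {zero}  f g f≗g = refl
tabulate≡segment {suc m} f g f≗g = cong₂ _∷_ (f≗g fz) (tabulate≡segment (f ∘ fs) (g ∘ suc) (f≗g ∘ fs))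

module Ascent (g : ℕ → ℕ) where

  Ascending : ℕ → ℕ → Set
  Ascending a b = ∀ p → a ≤ p → suc p < b → g p < g (suc p)

  -- [a, b) splits into j + 1 consecutive ascending runs.
  Runs : ℕ → ℕ → ℕ → Set
  Runs zero    a b = Ascending a b
  Runs (suc j) a b = Σ ℕ λ d → a ≤ d × d ≤ b × Ascending a d × Runs j d b

  ascending-short : ∀ {a b} → b ≤ suc a → Ascending a b
  ascending-short b≤1+a p a≤p 1+p<b = ⊥-elim (<⇒≱ (≤-pred (≤-trans 1+p<b b≤1+a)) a≤p)

  ascending⇒runs : ∀ j {a b} → a ≤ b → Ascending a b → Runs j a b
  ascending⇒runs zero        a≤b asc = asc
  ascending⇒runs (suc j) {a} a≤b asc = a , ≤-refl , a≤b , ascending-short (n≤1+n a) , ascending⇒runs j a≤b asc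

  ascending-cons : ∀ {a b} → g a < g (suc a) → Ascending (suc a) b → Ascending a b
  ascending-cons ga<ga+1 asc p a≤p 1+p<b with m≤n⇒m<n∨m≡n a≤p
  ... | inj₁ a<p  = asc p a<p 1+p<b
  ... | inj₂ refl = ga<ga+1

  runs-cons : ∀ j {a b} → g a < g (suc a) → Runs j (suc a) b → Runs j a b
  runs-cons zero        ga<ga+1 asc = ascending-cons ga<ga+1 asc
  runs-cons (suc j) {a} ga<ga+1 (d , a<d , d≤b , asc , runs) =
    d , ≤-trans (n≤1+n a) a<d , d≤b , ascending-cons ga<ga+1 asc , runs

  ascending-< : ∀ {a b} → Ascending a b → ∀ {p q} → a ≤ p → p < q → q < b → g p < g q
  ascending-< asc {p} {suc q} a≤p p<1+q 1+q<b with m≤n⇒m<n∨m≡n (≤-pred p<1+q)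
  ... | inj₁ p<q  = <-trans (ascending-< asc a≤p p<q (<-trans (n<1+n q) 1+q<b)) (asc q (≤-trans a≤p (<⇒≤ p<q)) 1+q<b)
  ... | inj₂ refl = asc p a≤p 1+q<b

  ascending-≤ : ∀ {a b} → Ascending a b → ∀ {p q} → a ≤ p → p ≤ q → q < b → g p ≤ g q
  ascending-≤ asc a≤p p≤q q<b with m≤n⇒m<n∨m≡n p≤q
  ... | inj₁ p<q  = <⇒≤ (ascending-< asc a≤p p<q q<b)
  ... | inj₂ refl = ≤-refl

  ascending-mono : ∀ {a b a′ b′} → a ≤ a′ → b′ ≤ b → Ascending a b → Ascending a′ b′
  ascending-mono a≤a′ b′≤b asc p a′≤p 1+p<b′ = asc p (≤-trans a≤a′ a′≤p) (<-≤-trans 1+p<b′ b′≤b)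

  Cut : ℕ → ℕ → ℕ → Set
  Cut a b t = Σ ℕ λ m → a ≤ m × m ≤ b × (∀ p → a ≤ p → p < m → g p < t) × (∀ p → m ≤ p → p < b → t ≤ g p)

  cut-empty : ∀ a t → Cut a a t
  cut-empty a t = a , ≤-refl , ≤-refl , (λ p a≤p p<a → ⊥-elim (<⇒≱ p<a a≤p)) , (λ p a≤p p<a → ⊥-elim (<⇒≱ p<a a≤p))

  cut : ∀ {a} b t → a ≤ b → Ascending a b → Cut a b t
  cut zero t z≤n asc = cut-empty 0 t
  cut {a} (suc b) t a≤1+b asc with m≤n⇒m<n∨m≡n a≤1+b
  ... | inj₂ refl = cut-empty a t
  ... | inj₁ (s≤s a≤b) with t ≤? g b
  ...   | no t≰gb = suc b , a≤1+b , ≤-refl , below , λ p 1+b≤p p<1+b → ⊥-elim (<⇒≱ p<1+b 1+b≤p)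
    where
      below : ∀ p → a ≤ p → p < suc b → g p < t
      below p a≤p p<1+b = ≤-<-trans (ascending-≤ asc a≤p (≤-pred p<1+b) (n<1+n b)) (≰⇒> t≰gb)
  ...   | yes t≤gb with cut b t a≤b (ascending-mono ≤-refl (n≤1+n b) asc)
  ...     | m , a≤m , m≤b , below , above = m , a≤m , m≤n⇒m≤1+n m≤b , below , above′
    where
      above′ : ∀ p → m ≤ p → p < suc b → t ≤ g p
      above′ p m≤p p<1+b with m≤n⇒m<n∨m≡n (≤-pred p<1+b)
      ... | inj₁ p<b  = above p m≤p p<b
      ... | inj₂ refl = t≤gb

open Ascent

ascending-shift : ∀ g {a b} → Ascending (g ∘ suc) a b → Ascending g (suc a) (suc b)
ascending-shift g asc (suc p) (s≤s a≤p) (s≤s 1+p<b) = asc p a≤p 1+p<b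

runs-shift : ∀ g j {a b} → Runs (g ∘ suc) j a b → Runs g j (suc a) (suc b)
runs-shift g zero    asc = ascending-shift g asc
runs-shift g (suc j) (d , a≤d , d≤b , asc , runs) = suc d , s≤s a≤d , s≤s d≤b , ascending-shift g asc , runs-shift g j runs

-- With adjacent values distinct, every non-descent is an ascent, so the descents are the only run breaks.
runs-of-descents′ : ∀ m j (g : ℕ → ℕ) → (∀ k → suc k < suc m → g k ≢ g (suc k)) →
  desFrom (g 0) (segment (g ∘ suc) m) ≤ j → Runs g j 0 (suc m)
runs-of-descents′ zero    j g _ _ = ascending⇒runs g j z≤n (ascending-short g ≤-refl)
runs-of-descents′ (suc m) j g distinct des≤j with g 1 <? g 0
... | yes _    = runs-after-descent j des≤j
  where
    runs-after-descent : ∀ j → suc (desFrom (g 1) (segment (g ∘ suc ∘ suc) m)) ≤ j → Runs g j 0 (suc (suc m))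
    runs-after-descent (suc j) (s≤s des≤j) =
      1 , z≤n , s≤s z≤n , ascending-short g ≤-refl ,
      runs-shift g j (runs-of-descents′ m j (g ∘ suc) (λ k → distinct (suc k) ∘ s≤s) des≤j)
... | no g1≮g0 =
  runs-cons g j g0<g1 (runs-shift g j (runs-of-descents′ m j (g ∘ suc) (λ k → distinct (suc k) ∘ s≤s) des≤j))
  where
    g0<g1 : g 0 < g 1
    g0<g1 = ≤∧≢⇒< (≮⇒≥ g1≮g0) (distinct 0 (s≤s (s≤s z≤n)))

runs-of-descents : ∀ m j (g : ℕ → ℕ) → (∀ k → suc k < m → g k ≢ g (suc k)) →
  desList (segment g m) ≤ j → Runs g j 0 m
runs-of-descents zero    j g _        _    = ascending⇒runs g j z≤n (ascending-short g z≤n)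
runs-of-descents (suc m) j g distinct des≤j = runs-of-descents′ m j g distinct des≤j

Increasing : ∀ {k} → (Fin k → ℕ) → Set
Increasing f = ∀ i j → toℕ i < toℕ j → f i < f j

adjacent-<⇒increasing : ∀ {k} (f : Fin (suc k) → ℕ) → (∀ i → f (inject₁ i) < f (fs i)) → Increasing f
adjacent-<⇒increasing {suc k} f adj 0F     (fs 0F)     _         = adj 0F
adjacent-<⇒increasing {suc k} f adj 0F     (fs (fs j)) _         =
  <-trans (adj 0F) (adjacent-<⇒increasing (f ∘ fs) (adj ∘ fs) 0F (fs j) (s≤s z≤n))
adjacent-<⇒increasing {suc k} f adj (fs i) (fs j)      (s≤s i<j) = adjacent-<⇒increasing (f ∘ fs) (adj ∘ fs) i j i<j

-- Positions outside [0, n) get the junk value 0.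
extend : ∀ {n} → (Fin n → ℕ) → ℕ → ℕ
extend {n} h k with k <? n
... | yes k<n = h (fromℕ< k<n)
... | no _    = 0

extend-fromℕ< : ∀ {n} (h : Fin n → ℕ) {k} (k<n : k < n) → extend h k ≡ h (fromℕ< k<n)
extend-fromℕ< {n} h {k} k<n with k <? n
... | yes _    = refl
... | no k≮n  = ⊥-elim (k≮n k<n)

extend-toℕ : ∀ {n} (h : Fin n → ℕ) (p : Fin n) → extend h (toℕ p) ≡ h p
extend-toℕ h p = trans (extend-fromℕ< h (toℕ<n p)) (cong h (fromℕ<-toℕ p (toℕ<n p)))

module PermutationSequence {n} (π : Perm n) where

  value : ℕ → ℕ
  value = extend (π ⟨_⟩)

  value-toℕ : ∀ p → value (toℕ p) ≡ π ⟨ p ⟩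
  value-toℕ = extend-toℕ (π ⟨_⟩)

  value-fromℕ< : ∀ {k} (k<n : k < n) → value k ≡ π ⟨ fromℕ< k<n ⟩
  value-fromℕ< = extend-fromℕ< (π ⟨_⟩)

  des≡desList-segment : des π ≡ desList (segment value n)
  des≡desList-segment =
    cong desList (trans (map-tabulate id (π ⟨_⟩)) (tabulate≡segment (π ⟨_⟩) value (sym ∘ value-toℕ)))

  value<n : ∀ {k} → k < n → value k < n
  value<n k<n = subst (_< n) (sym (value-fromℕ< k<n)) (toℕ<n _)

  value-injective : ∀ {k l} → k < n → l < n → value k ≡ value l → k ≡ l
  value-injective {k} {l} k<n l<n eq = begin
    k                 ≡⟨ sym (toℕ-fromℕ< k<n) ⟩
    toℕ (fromℕ< k<n)  ≡⟨ cong toℕ (Injection.injective (↔⇒↣ π) (toℕ-injective π-eq)) ⟩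
    toℕ (fromℕ< l<n)  ≡⟨ toℕ-fromℕ< l<n ⟩
    l                 ∎
    where
      open ≡-Reasoning
      π-eq : π ⟨ fromℕ< k<n ⟩ ≡ π ⟨ fromℕ< l<n ⟩
      π-eq = trans (sym (value-fromℕ< k<n)) (trans eq (value-fromℕ< l<n))

  value-distinct : ∀ {k l} → k < l → l < n → value k ≢ value l
  value-distinct k<l l<n eq = <-irrefl (value-injective (<-trans k<l l<n) l<n eq) k<l

  -- An involution is its own inverse, so value ∘ P ∘ σ lists the values of the occurrence in increasing order.
  contains-involution : ∀ {k} (σ : Fin k → Fin k) → (∀ i → σ (σ i) ≡ i) → (P : Fin k → ℕ) → (∀ i → P i < n) →
    Increasing P → Increasing (value ∘ P ∘ σ) → Contains π σ
  contains-involution {k} σ σ-involutive P P<n P-increasing values-increasing =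
    position , position-increasing , λ i j → order-preserved i j , order-reflected i j
    where
      position : Fin k → Fin n
      position i = fromℕ< (P<n i)

      position-increasing : ∀ i j → toℕ i < toℕ j → toℕ (position i) < toℕ (position j)
      position-increasing i j i<j = subst₂ _<_ (sym (toℕ-fromℕ< _)) (sym (toℕ-fromℕ< _)) (P-increasing i j i<j)

      order-preserved : ∀ i j → toℕ (σ i) < toℕ (σ j) → π ⟨ position i ⟩ < π ⟨ position j ⟩
      order-preserved i j σi<σj =
        subst₂ _<_ (value-fromℕ< (P<n i)) (value-fromℕ< (P<n j))
          (subst₂ (λ a b → value (P a) < value (P b)) (σ-involutive i) (σ-involutive j) (values-increasing _ _ σi<σj))

      order-reflected : ∀ i j → π ⟨ position i ⟩ < π ⟨ position j ⟩ → toℕ (σ i) < toℕ (σ j)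
      order-reflected i j πi<πj with <-cmp (toℕ (σ i)) (toℕ (σ j))
      ... | tri< σi<σj _ _ = σi<σj
      ... | tri> _ _ σj<σi = ⊥-elim (<-asym πi<πj (order-preserved j i σj<σi))
      ... | tri≈ _ σi≡σj _ = ⊥-elim (<-irrefl (cong (λ a → π ⟨ position a ⟩) i≡j) πi<πj)
        where
          i≡j : i ≡ j
          i≡j = trans (sym (σ-involutive i)) (trans (cong σ (toℕ-injective σi≡σj)) (σ-involutive j))

  contains-2143 : ∀ {p₀ p₁ p₂ p₃} → p₀ < p₁ → p₁ < p₂ → p₂ < p₃ → p₃ < n →
    value p₁ < value p₀ → value p₀ < value p₃ → value p₃ < value p₂ → Contains π p2143
  contains-2143 {p₀} {p₁} {p₂} {p₃} p₀<p₁ p₁<p₂ p₂<p₃ p₃<n v₁<v₀ v₀<v₃ v₃<v₂ =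
    contains-involution p2143 (λ { 0F → refl ; 1F → refl ; 2F → refl ; 3F → refl }) P P<n P-increasing
      (adjacent-<⇒increasing (value ∘ P ∘ p2143) λ { 0F → v₁<v₀ ; 1F → v₀<v₃ ; 2F → v₃<v₂ })
    where
      P : Fin 4 → ℕ
      P = lookup (p₀ ∷ᵛ p₁ ∷ᵛ p₂ ∷ᵛ p₃ ∷ᵛ []ᵛ)
      P-increasing : Increasing P
      P-increasing = adjacent-<⇒increasing P λ { 0F → p₀<p₁ ; 1F → p₁<p₂ ; 2F → p₂<p₃ }
      P<n : ∀ i → P i < n
      P<n 0F = <-trans (P-increasing 0F 3F (s≤s z≤n)) p₃<n
      P<n 1F = <-trans (P-increasing 1F 3F (s≤s (s≤s z≤n))) p₃<n
      P<n 2F = <-trans p₂<p₃ p₃<n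
      P<n 3F = p₃<n

InBand : ∀ {k} → (Fin (suc k) → ℕ) → Fin k → ℕ → Set
InBand c i x = c (inject₁ i) ≤ x × x < c (fs i)

NonDecreasing : ∀ {k} → (Fin (suc k) → ℕ) → Set
NonDecreasing c = ∀ i → c (inject₁ i) ≤ c (fs i)

band-of : ∀ {k} (c : Fin (suc k) → ℕ) {x} → c fz ≤ x → x < c (fromℕ k) → Σ (Fin k) λ i → InBand c i x
band-of {zero}  c c0≤x x<c0 = ⊥-elim (<⇒≱ x<c0 c0≤x)
band-of {suc k} c {x} c0≤x x<ck with x <? c 1F
... | yes x<c1 = fz , c0≤x , x<c1
... | no x≮c1 with band-of (c ∘ fs) (≮⇒≥ x≮c1) x<ck
...   | i , x∈i = fs i , x∈i

nonDecreasing-≤ : ∀ {k} (c : Fin (suc k) → ℕ) → NonDecreasing c → ∀ {a b} → toℕ a ≤ toℕ b → c a ≤ c b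
nonDecreasing-≤ c       mono {fz}   {fz}   _         = ≤-refl
nonDecreasing-≤ {suc k} c mono {fz}   {fs b} _         = ≤-trans (mono fz) (nonDecreasing-≤ (c ∘ fs) (mono ∘ fs) {fz} {b} z≤n)
nonDecreasing-≤ {suc k} c mono {fs a} {fs b} (s≤s a≤b) = nonDecreasing-≤ (c ∘ fs) (mono ∘ fs) a≤b

band-mono : ∀ {k} (c : Fin (suc k) → ℕ) → NonDecreasing c →
  ∀ {i j x y} → InBand c i x → InBand c j y → x ≤ y → toℕ i ≤ toℕ j
band-mono c mono {i} {j} {x} {y} (ci≤x , _) (_ , y<cj+1) x≤y = ≮⇒≥ j<i⇒⊥
  where
    j<i⇒⊥ : toℕ j < toℕ i → ⊥
    j<i⇒⊥ j<i = <⇒≱ (<-≤-trans y<cj+1 cj+1≤ci) (≤-trans ci≤x x≤y)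
      where
        cj+1≤ci : c (fs j) ≤ c (inject₁ i)
        cj+1≤ci = nonDecreasing-≤ c mono (subst (suc (toℕ j) ≤_) (sym (toℕ-inject₁ i)) j<i)

band-unique : ∀ {k} (c : Fin (suc k) → ℕ) → NonDecreasing c → ∀ {i j x} → InBand c i x → InBand c j x → i ≡ j
band-unique c mono x∈i x∈j =
  toℕ-injective (≤-antisym (band-mono c mono x∈i x∈j ≤-refl) (band-mono c mono x∈j x∈i ≤-refl))

-- As gridC has exactly one increasing cell per column, a gridding by gridC amounts to cuts whose
-- columns are increasing and lie in the row band prescribed by rowOf.
record ColumnGridding {n} (π : Perm n) : Set where
  field
    c : Fin 9 → ℕ
    r : Fin 5 → ℕ
    c-first : c fz ≡ 0
    c-last  : c (fromℕ 8) ≡ n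
    c-mono  : NonDecreasing c
    r-first : r fz ≡ 0
    r-last  : r (fromℕ 4) ≡ n
    r-mono  : NonDecreasing r
    column-in-row    : ∀ i p → InBand c i (toℕ p) → InBand r (rowOf i) (π ⟨ p ⟩)
    column-ascending : ∀ i p q → InBand c i (toℕ p) → InBand c i (toℕ q) → toℕ p < toℕ q → π ⟨ p ⟩ < π ⟨ q ⟩

fromInGrid : ∀ {n} {π : Perm n} → InGrid gridC π → ColumnGridding π
fromInGrid {n} {π} (c , r , c-first , c-last , c-mono , r-first , r-last , r-mono , cells) = record
  { c = c ; r = r ; c-first = c-first ; c-last = c-last ; c-mono = c-mono
  ; r-first = r-first ; r-last = r-last ; r-mono = r-mono
  ; column-in-row = column-in-row ; column-ascending = column-ascending
  }
  where
    -- Abstracting rowOf i ≟ j also in the type of cells i j makes that cell's condition compute.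
    row-of-cell : ∀ i j p → InBand c i (toℕ p) → InBand r j (π ⟨ p ⟩) → rowOf i ≡ j
    row-of-cell i j p (ci≤p , p<ci+1) (rj≤πp , πp<rj+1) with rowOf i ≟ j | cells i j
    ... | yes rowOf-i≡j | _          = rowOf-i≡j
    ... | no _          | unoccupied = ⊥-elim (unoccupied p (ci≤p , p<ci+1 , rj≤πp , πp<rj+1))

    column-in-row : ∀ i p → InBand c i (toℕ p) → InBand r (rowOf i) (π ⟨ p ⟩)
    column-in-row i p p∈i with band-of r (subst (_≤ π ⟨ p ⟩) (sym r-first) z≤n) (subst (π ⟨ p ⟩ <_) (sym r-last) (toℕ<n _))
    ... | j , πp∈j rewrite row-of-cell i j p p∈i πp∈j = πp∈j

    column-ascending : ∀ i p q → InBand c i (toℕ p) → InBand c i (toℕ q) → toℕ p < toℕ q → π ⟨ p ⟩ < π ⟨ q ⟩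
    column-ascending i p q p∈i q∈i with rowOf i ≟ rowOf i | cells i (rowOf i)
    ... | no rowOf-i≢rowOf-i | _         = ⊥-elim (rowOf-i≢rowOf-i refl)
    ... | yes _              | ascending =
      ascending p q (proj₁ p∈i , proj₂ p∈i , column-in-row i p p∈i) (proj₁ q∈i , proj₂ q∈i , column-in-row i q q∈i)

toInGrid : ∀ {n} {π : Perm n} → ColumnGridding π → InGrid gridC π
-- The cell conditions of gridC i j only compute for concrete i and j.
toInGrid {n} {π} G = c , r , c-first , c-last , c-mono , r-first , r-last , r-mono , λ where
    0F 0F → ascending 0F
    0F 1F → unoccupied 0F 1F λ ()
    0F 2F → unoccupied 0F 2F λ ()
    0F 3F → unoccupied 0F 3F λ ()
    1F 0F → unoccupied 1F 0F λ ()
    1F 1F → unoccupied 1F 1F λ ()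
    1F 2F → ascending 1F
    1F 3F → unoccupied 1F 3F λ ()
    2F 0F → unoccupied 2F 0F λ ()
    2F 1F → unoccupied 2F 1F λ ()
    2F 2F → unoccupied 2F 2F λ ()
    2F 3F → ascending 2F
    3F 0F → unoccupied 3F 0F λ ()
    3F 1F → ascending 3F
    3F 2F → unoccupied 3F 2F λ ()
    3F 3F → unoccupied 3F 3F λ ()
    4F 0F → unoccupied 4F 0F λ ()
    4F 1F → unoccupied 4F 1F λ ()
    4F 2F → ascending 4F
    4F 3F → unoccupied 4F 3F λ ()
    5F 0F → ascending 5F
    5F 1F → unoccupied 5F 1F λ ()
    5F 2F → unoccupied 5F 2F λ ()
    5F 3F → unoccupied 5F 3F λ ()
    6F 0F → unoccupied 6F 0F λ ()
    6F 1F → ascending 6F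
    6F 2F → unoccupied 6F 2F λ ()
    6F 3F → unoccupied 6F 3F λ ()
    7F 0F → unoccupied 7F 0F λ ()
    7F 1F → unoccupied 7F 1F λ ()
    7F 2F → unoccupied 7F 2F λ ()
    7F 3F → ascending 7F
  where
    open ColumnGridding G

    Occupies : Fin 8 → Fin 4 → Fin n → Set
    Occupies i j p = c (inject₁ i) ≤ toℕ p × toℕ p < c (fs i) × r (inject₁ j) ≤ π ⟨ p ⟩ × π ⟨ p ⟩ < r (fs j)

    ascending : ∀ i p q → Occupies i (rowOf i) p → Occupies i (rowOf i) q → toℕ p < toℕ q → π ⟨ p ⟩ < π ⟨ q ⟩
    ascending i p q (ci≤p , p<ci+1 , _) (ci≤q , q<ci+1 , _) = column-ascending i p q (ci≤p , p<ci+1) (ci≤q , q<ci+1)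

    unoccupied : ∀ i j → rowOf i ≢ j → ∀ p → Occupies i j p → ⊥
    unoccupied i j rowOf-i≢j p (ci≤p , p<ci+1 , πp∈j) =
      rowOf-i≢j (band-unique r r-mono (column-in-row i p (ci≤p , p<ci+1)) πp∈j)

DescentStep : Fin 8 → Fin 8 → Set
DescentStep a b = toℕ a < toℕ b × toℕ (rowOf b) ≤ toℕ (rowOf a)

descentStep? : ∀ a b → Dec (DescentStep a b)
descentStep? a b = (toℕ a <? toℕ b) ×-dec (toℕ (rowOf b) ≤? toℕ (rowOf a))

-- potential i is the length of the longest chain of descent steps starting in a column ≥ i.
potential : Fin 8 → ℕ
potential = lookup (2 ∷ᵛ 2 ∷ᵛ 2 ∷ᵛ 1 ∷ᵛ 1 ∷ᵛ 0 ∷ᵛ 0 ∷ᵛ 0 ∷ᵛ []ᵛ)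

potential≤2 : ∀ a → potential a ≤ 2
potential≤2 = toWitness {a? = all? λ a → potential a ≤? 2} tt

potential-antitone : ∀ a b → toℕ a ≤ toℕ b → potential b ≤ potential a
potential-antitone = toWitness {a? = all? λ a → all? λ b → (toℕ a ≤? toℕ b) →-dec (potential b ≤? potential a)} tt

potential-drops : ∀ a b → DescentStep a b → potential b < potential a
potential-drops = toWitness {a? = all? λ a → all? λ b → descentStep? a b →-dec (potential b <? potential a)} tt

no-2143-columns : ∀ a b c d → DescentStep a b → toℕ b ≤ toℕ c → DescentStep c d → toℕ (rowOf d) < toℕ (rowOf a)
no-2143-columns = toWitness {a? = all? λ a → all? λ b → all? λ c → all? λ d →
  descentStep? a b →-dec ((toℕ b ≤? toℕ c) →-dec (descentStep? c d →-dec (toℕ (rowOf d) <? toℕ (rowOf a))))} tt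

module Occurrence {n k} (π : Perm n) (σ : Fin k → Fin k) (occ : Contains π σ) where

  position : Fin k → Fin n
  position = proj₁ occ

  position-< : ∀ i j → {True (toℕ i <? toℕ j)} → toℕ (position i) < toℕ (position j)
  position-< i j {i<j} = proj₁ (proj₂ occ) i j (toWitness i<j)

  value-< : ∀ i j → {True (toℕ (σ i) <? toℕ (σ j))} → π ⟨ position i ⟩ < π ⟨ position j ⟩
  value-< i j {σi<σj} = proj₁ (proj₂ (proj₂ occ) i j) (toWitness σi<σj)

module ColumnGriddingFacts {n} {π : Perm n} (G : ColumnGridding π) where
  open ColumnGridding G

  column-of : ∀ p → Σ (Fin 8) λ i → InBand c i (toℕ p)
  column-of p = band-of c (subst (_≤ toℕ p) (sym c-first) z≤n) (subst (toℕ p <_) (sym c-last) (toℕ<n p))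

  column : Fin n → Fin 8
  column p = proj₁ (column-of p)

  in-column : ∀ p → InBand c (column p) (toℕ p)
  in-column p = proj₂ (column-of p)

  column-mono : ∀ {p q} → toℕ p < toℕ q → toℕ (column p) ≤ toℕ (column q)
  column-mono p<q = band-mono c c-mono (in-column _) (in-column _) (<⇒≤ p<q)

  row-mono : ∀ {p q} → π ⟨ p ⟩ < π ⟨ q ⟩ → toℕ (rowOf (column p)) ≤ toℕ (rowOf (column q))
  row-mono πp<πq = band-mono r r-mono (column-in-row _ _ (in-column _)) (column-in-row _ _ (in-column _)) (<⇒≤ πp<πq)

  descent-step : ∀ {p q} → toℕ p < toℕ q → π ⟨ q ⟩ < π ⟨ p ⟩ → DescentStep (column p) (column q)
  descent-step {p} {q} p<q πq<πp = ≤∧≢⇒< (column-mono p<q) same-column⇒⊥ , row-mono πq<πp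
    where
      same-column⇒⊥ : toℕ (column p) ≢ toℕ (column q)
      same-column⇒⊥ eq = <-asym πq<πp (column-ascending (column p) p q (in-column p) q∈column-p p<q)
        where
          q∈column-p : InBand c (column p) (toℕ q)
          q∈column-p = subst (λ i → InBand c i (toℕ q)) (sym (toℕ-injective eq)) (in-column q)

  avoids-2143 : ¬ Contains π p2143
  avoids-2143 occ = <⇒≱ (no-2143-columns _ _ _ _ step₀₁ column₁≤column₂ step₂₃) (row-mono (value-< 0F 3F))
    where
      open Occurrence π p2143 occ
      step₀₁ : DescentStep (column (position 0F)) (column (position 1F))
      step₀₁ = descent-step (position-< 0F 1F) (value-< 1F 0F)
      column₁≤column₂ : toℕ (column (position 1F)) ≤ toℕ (column (position 2F))
      column₁≤column₂ = column-mono (position-< 1F 2F)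
      step₂₃ : DescentStep (column (position 2F)) (column (position 3F))
      step₂₃ = descent-step (position-< 2F 3F) (value-< 3F 2F)

  avoids-4321 : ¬ Contains π p4321
  avoids-4321 occ = <⇒≱ 3≤potential₀ (potential≤2 (column (position 0F)))
    where
      open Occurrence π p4321 occ
      drop : ∀ i j → {True (toℕ i <? toℕ j)} → {True (toℕ (p4321 j) <? toℕ (p4321 i))} →
             potential (column (position j)) < potential (column (position i))
      drop i j {i<j} {σj<σi} = potential-drops _ _ (descent-step (position-< i j {i<j}) (value-< j i {σj<σi}))
      3≤potential₀ : 3 ≤ potential (column (position 0F))
      3≤potential₀ = ≤-trans (s≤s (≤-trans (s≤s (≤-trans (s≤s z≤n) (drop 2F 3F))) (drop 1F 2F))) (drop 0F 1F)

des≤2 : ∀ {n} {π : Perm n} → ColumnGridding π → des π ≤ 2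
des≤2 {zero}      _ = z≤n
des≤2 {suc m} {π} G = begin
  des π                            ≡⟨ cong desList (map-tabulate id (π ⟨_⟩)) ⟩
  desList (tabulate (π ⟨_⟩))       ≤⟨ descents≤potential (π ⟨_⟩) (potential ∘ column) antitone drops ⟩
  potential (column 0F)            ≤⟨ potential≤2 (column 0F) ⟩
  2                                ∎
  where
    open ≤-Reasoning
    open ColumnGriddingFacts G
    adjacent : ∀ (i : Fin m) → toℕ (inject₁ i) < toℕ (fs i)
    adjacent i = ≤̄⇒inject₁< ≤-refl
    antitone : ∀ i → potential (column (fs i)) ≤ potential (column (inject₁ i))
    antitone i = potential-antitone _ _ (column-mono (adjacent i))
    drops : ∀ i → π ⟨ fs i ⟩ < π ⟨ inject₁ i ⟩ → potential (column (fs i)) < potential (column (inject₁ i))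
    drops i desc = potential-drops _ _ (descent-step (adjacent i) desc)

module Backward {n} (π : Perm n) where
  open PermutationSequence π

  three-runs-gridding : ∀ {d₁ d₂ r₁ r₂ r₃} → d₁ ≤ d₂ → d₂ ≤ n → r₁ ≤ r₂ → r₂ ≤ r₃ → r₃ ≤ n →
    Ascending value 0 d₁ → Ascending value d₁ d₂ → Ascending value d₂ n →
    (∀ p → p < d₁ → r₁ ≤ value p → r₂ ≤ value p) →
    (∀ p → d₁ ≤ p → p < d₂ → r₁ ≤ value p × value p < r₃) →
    (∀ p → d₂ ≤ p → p < n → r₂ ≤ value p → r₃ ≤ value p) →
    ColumnGridding π
  three-runs-gridding {d₁} {d₂} {r₁} {r₂} {r₃} d₁≤d₂ d₂≤n r₁≤r₂ r₂≤r₃ r₃≤n ascA ascB ascC gapA inB gapC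
      with cut value d₁ r₁ z≤n ascA
  ... | m₁ , _ , m₁≤d₁ , belowA₁ , aboveA₁
      with cut value d₁ r₃ m₁≤d₁ (ascending-mono value z≤n ≤-refl ascA)
  ... | m₂ , m₁≤m₂ , m₂≤d₁ , belowA₂ , aboveA₂
      with cut value d₂ r₂ d₁≤d₂ ascB
  ... | m₃ , d₁≤m₃ , m₃≤d₂ , belowB , aboveB
      with cut value n r₁ d₂≤n ascC
  ... | m₄ , d₂≤m₄ , m₄≤n , belowC₁ , aboveC₁
      with cut value n r₂ m₄≤n (ascending-mono value d₂≤m₄ ≤-refl ascC)
  ... | m₅ , m₄≤m₅ , m₅≤n , belowC₂ , aboveC₂ = record
    { c = c ; r = r ; c-first = refl ; c-last = refl ; c-mono = c-mono
    ; r-first = refl ; r-last = refl ; r-mono = r-mono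
    ; column-in-row = λ i p p∈i → subst (InBand r (rowOf i)) (value-toℕ p) (column-in-row i p∈i)
    ; column-ascending = λ i p q p∈i q∈i p<q →
        subst₂ _<_ (value-toℕ p) (value-toℕ q) (column-ascending i p∈i q∈i p<q)
    }
    where
      c : Fin 9 → ℕ
      c = lookup (0 ∷ᵛ m₁ ∷ᵛ m₂ ∷ᵛ d₁ ∷ᵛ m₃ ∷ᵛ d₂ ∷ᵛ m₄ ∷ᵛ m₅ ∷ᵛ n ∷ᵛ []ᵛ)

      r : Fin 5 → ℕ
      r = lookup (0 ∷ᵛ r₁ ∷ᵛ r₂ ∷ᵛ r₃ ∷ᵛ n ∷ᵛ []ᵛ)

      c-mono : NonDecreasing c
      c-mono 0F = z≤n
      c-mono 1F = m₁≤m₂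
      c-mono 2F = m₂≤d₁
      c-mono 3F = d₁≤m₃
      c-mono 4F = m₃≤d₂
      c-mono 5F = d₂≤m₄
      c-mono 6F = m₄≤m₅
      c-mono 7F = m₅≤n

      r-mono : NonDecreasing r
      r-mono 0F = z≤n
      r-mono 1F = r₁≤r₂
      r-mono 2F = r₂≤r₃
      r-mono 3F = r₃≤n

      column-in-row : ∀ i {p} → InBand c i p → InBand r (rowOf i) (value p)
      column-in-row 0F (_ , p<m₁) = z≤n , belowA₁ _ z≤n p<m₁
      column-in-row 1F (m₁≤p , p<m₂) =
        gapA _ (<-≤-trans p<m₂ m₂≤d₁) (aboveA₁ _ m₁≤p (<-≤-trans p<m₂ m₂≤d₁)) , belowA₂ _ m₁≤p p<m₂
      column-in-row 2F (m₂≤p , p<d₁) = aboveA₂ _ m₂≤p p<d₁ , value<n (<-≤-trans p<d₁ (≤-trans d₁≤d₂ d₂≤n))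
      column-in-row 3F (d₁≤p , p<m₃) = proj₁ (inB _ d₁≤p (<-≤-trans p<m₃ m₃≤d₂)) , belowB _ d₁≤p p<m₃
      column-in-row 4F (m₃≤p , p<d₂) = aboveB _ m₃≤p p<d₂ , proj₂ (inB _ (≤-trans d₁≤m₃ m₃≤p) p<d₂)
      column-in-row 5F (d₂≤p , p<m₄) = z≤n , belowC₁ _ d₂≤p p<m₄
      column-in-row 6F (m₄≤p , p<m₅) = aboveC₁ _ m₄≤p (<-≤-trans p<m₅ m₅≤n) , belowC₂ _ m₄≤p p<m₅
      column-in-row 7F (m₅≤p , p<n) =
        gapC _ (≤-trans d₂≤m₄ (≤-trans m₄≤m₅ m₅≤p)) p<n (aboveC₂ _ m₅≤p p<n) , value<n p<n

      column-ascending : ∀ i {p q} → InBand c i p → InBand c i q → p < q → value p < value q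
      column-ascending 0F _          (_ , q<m₁) p<q = ascending-< value ascA z≤n p<q (<-≤-trans q<m₁ m₁≤d₁)
      column-ascending 1F _          (_ , q<m₂) p<q = ascending-< value ascA z≤n p<q (<-≤-trans q<m₂ m₂≤d₁)
      column-ascending 2F _          (_ , q<d₁) p<q = ascending-< value ascA z≤n p<q q<d₁
      column-ascending 3F (d₁≤p , _) (_ , q<m₃) p<q = ascending-< value ascB d₁≤p p<q (<-≤-trans q<m₃ m₃≤d₂)
      column-ascending 4F (m₃≤p , _) (_ , q<d₂) p<q = ascending-< value ascB (≤-trans d₁≤m₃ m₃≤p) p<q q<d₂
      column-ascending 5F (d₂≤p , _) (_ , q<m₄) p<q = ascending-< value ascC d₂≤p p<q (<-≤-trans q<m₄ m₄≤n)
      column-ascending 6F (m₄≤p , _) (_ , q<m₅) p<q = ascending-< value ascC (≤-trans d₂≤m₄ m₄≤p) p<q (<-≤-trans q<m₅ m₅≤n)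
      column-ascending 7F (m₅≤p , _) (_ , q<n)  p<q = ascending-< value ascC (≤-trans d₂≤m₄ (≤-trans m₄≤m₅ m₅≤p)) p<q q<n

  nonempty-middle-gridding : ∀ {d₁ b} → d₁ ≤ b → b < n →
    Ascending value 0 d₁ → Ascending value d₁ (suc b) → Ascending value (suc b) n → ¬ Contains π p2143 →
    ColumnGridding π
  nonempty-middle-gridding {d₁} {b} d₁≤b b<n ascA ascB ascC avoids with cut value d₁ (value d₁) z≤n ascA
  ... | m , _ , _ , belowA , aboveA = choose (m <? d₁)
    where
      r₁ r₃ : ℕ
      r₁ = value d₁
      r₃ = suc (value b)

      r₁≤r₃ : r₁ ≤ r₃
      r₁≤r₃ = m≤n⇒m≤1+n (ascending-≤ value ascB ≤-refl d₁≤b (n<1+n b))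

      inB : ∀ p → d₁ ≤ p → p < suc b → r₁ ≤ value p × value p < r₃
      inB p d₁≤p p<1+b = ascending-≤ value ascB ≤-refl d₁≤p p<1+b , s≤s (ascending-≤ value ascB d₁≤p (≤-pred p<1+b) (n<1+n b))

      reaches-r₁⇒m≤ : ∀ p → p < d₁ → r₁ ≤ value p → m ≤ p
      reaches-r₁⇒m≤ p p<d₁ r₁≤vp = ≮⇒≥ λ p<m → <⇒≱ (belowA p z≤n p<m) r₁≤vp

      gridding : ∀ r₂ → r₁ ≤ r₂ → r₂ ≤ r₃ →
        (∀ p → p < d₁ → r₁ ≤ value p → r₂ ≤ value p) → (∀ p → suc b ≤ p → p < n → r₂ ≤ value p → r₃ ≤ value p) →
        ColumnGridding π
      gridding r₂ r₁≤r₂ r₂≤r₃ gapA gapC =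
        three-runs-gridding (≤-trans d₁≤b (n≤1+n b)) b<n r₁≤r₂ r₂≤r₃ (value<n b<n) ascA ascB ascC gapA inB gapC

      gridding-r₂=r₃ : (m < d₁ → r₃ ≤ value m) → ColumnGridding π
      gridding-r₂=r₃ m<d₁⇒r₃≤vm = gridding r₃ r₁≤r₃ ≤-refl gapA (λ _ _ _ → id)
        where
          gapA : ∀ p → p < d₁ → r₁ ≤ value p → r₃ ≤ value p
          gapA p p<d₁ r₁≤vp = ≤-trans (m<d₁⇒r₃≤vm (≤-<-trans (reaches-r₁⇒m≤ p p<d₁ r₁≤vp) p<d₁))
                                      (ascending-≤ value ascA z≤n (reaches-r₁⇒m≤ p p<d₁ r₁≤vp) p<d₁)

      gridding-r₂=value-m : m < d₁ → value m < r₃ → ColumnGridding π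
      gridding-r₂=value-m m<d₁ vm<r₃ = gridding (value m) (aboveA m ≤-refl m<d₁) (<⇒≤ vm<r₃) gapA gapC
        where
          gapA : ∀ p → p < d₁ → r₁ ≤ value p → value m ≤ value p
          gapA p p<d₁ r₁≤vp = ascending-≤ value ascA z≤n (reaches-r₁⇒m≤ p p<d₁ r₁≤vp) p<d₁

          gapC : ∀ p → suc b ≤ p → p < n → value m ≤ value p → r₃ ≤ value p
          gapC p b<p p<n vm≤vp with r₃ ≤? value p
          ... | yes r₃≤vp = r₃≤vp
          ... | no r₃≰vp = ⊥-elim (2143-or-collapse (m≤n⇒m<n∨m≡n d₁≤b))
            where
              d₁<p : d₁ < p
              d₁<p = ≤-<-trans d₁≤b b<p
              v₁<v₀ : value d₁ < value m
              v₁<v₀ = ≤∧≢⇒< (aboveA m ≤-refl m<d₁) (value-distinct m<d₁ (<-trans d₁<p p<n) ∘ sym)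
              v₀<v₃ : value m < value p
              v₀<v₃ = ≤∧≢⇒< vm≤vp (value-distinct (<-trans m<d₁ d₁<p) p<n)
              v₃<v₂ : value p < value b
              v₃<v₂ = ≤∧≢⇒< (≤-pred (≰⇒> r₃≰vp)) (value-distinct b<p p<n ∘ sym)
              2143-or-collapse : d₁ < b ⊎ d₁ ≡ b → ⊥
              2143-or-collapse (inj₁ d₁<b) = avoids (contains-2143 m<d₁ d₁<b b<p p<n v₁<v₀ v₀<v₃ v₃<v₂)
              2143-or-collapse (inj₂ refl) = <-asym v₁<v₀ (<-trans v₀<v₃ v₃<v₂)

      choose : Dec (m < d₁) → ColumnGridding π
      choose (no m≮d₁) = gridding-r₂=r₃ (⊥-elim ∘ m≮d₁)
      choose (yes m<d₁) with value m <? r₃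
      ... | yes vm<r₃ = gridding-r₂=value-m m<d₁ vm<r₃
      ... | no vm≮r₃  = gridding-r₂=r₃ (λ _ → ≮⇒≥ vm≮r₃)

  gridding : ¬ Contains π p2143 → des π ≤ 2 → ColumnGridding π
  gridding avoids few-descents
      with runs-of-descents n 2 value (λ k → value-distinct (n<1+n k)) (subst (_≤ 2) des≡desList-segment few-descents)
  ... | d₁ , _ , _ , ascA , d₂ , d₁≤d₂ , d₂≤n , ascB , ascC with d₁ <? d₂
  ...   | yes (s≤s d₁≤b) = nonempty-middle-gridding d₁≤b d₂≤n ascA ascB ascC avoids
  ...   | no d₁≮d₂ = three-runs-gridding d₁≤d₂ d₂≤n z≤n z≤n z≤n ascA ascB ascC
                       (λ _ _ _ → z≤n) (λ p d₁≤p p<d₂ → ⊥-elim (d₁≮d₂ (≤-<-trans d₁≤p p<d₂))) (λ _ _ _ _ → z≤n)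

lemma3p3 : ∀ (n : ℕ) (π : Perm n) →
    InGrid gridC π ⇔ (InAv2143-4321 π × des π ≤ 2)
lemma3p3 n π = mk⇔ forward backward
  where
    forward : InGrid gridC π → InAv2143-4321 π × des π ≤ 2
    forward inGrid = (avoids-2143 , avoids-4321) , des≤2 G
      where
        G : ColumnGridding π
        G = fromInGrid inGrid
        open ColumnGriddingFacts G

    backward : InAv2143-4321 π × des π ≤ 2 → InGrid gridC π
    backward ((avoids , _) , few-descents) = toInGrid (Backward.gridding π avoids few-descents)
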